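{- Let $\mathcal{M}_1$ and $\mathcal{M}_2$ be quasi-discrete neighbourhood models and $\rho$ a modal bisimulation between them with $x_1\rho x_2$. Then for every SLCS formula $\varphi$ not containing the operator $\mathcal{R}$ (reachable), $\mathcal{M}_1,x_1\models\varphi$ if and only if $\mathcal{M}_2,x_2\models\varphi$.
   Context: A neighbourhood space $(X,\mathcal{N})$ assigns to each $x\in X$ a filter $\mathcal{N}(x)$ on $X$ (closed under non-empty finite intersections and supersets, $\emptyset\notin\mathcal{N}(x)$) with $x\in N$ for all $N\in\mathcal{N}(x)$. It is quasi-discrete if every $x$ has a minimal neighbourhood $\mathcal{N}_{\min}(x)\in\mathcal{N}(x)$ contained in every member of $\mathcal{N}(x)$. Closure: $\mathcal{C}(A)=\{x\mid\forall N\in\mathcal{N}(x):A\cap N\ne\emptyset\}$. A quasi-discrete neighbourhood model $(X,\mathcal{N},V)$ is a quasi-discrete space with valuation $V:X\to\mathcal{P}(\mathsf{P})$ and index space $\mathbb{N}$ (usual order, least element $0$, minimal neighbourhood of $n$ is $\{n,n+1\}$); paths are continuous maps $p:\mathbb{N}\to X$, i.e. maps with $p(n+1)\in\mathcal{N}_{\min}(p(n))$ for all $n$. Induced edge relation $R=\{(x,y)\mid y\in\mathcal{N}_{\min}(x)\}$. A relation $\rho\subseteq X_1\times X_2$ is a modal bisimulation if for every $x_1\rho x_2$: $V_1(x_1)=V_2(x_2)$; if $(x_1,y_1)\in R_1$ then there is $y_2$ with $(x_2,y_2)\in R_2$ and $y_1\rho y_2$; if $(x_2,y_2)\in R_2$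 then there is $y_1$ with $(x_1,y_1)\in R_1$ and $y_1\rho y_2$. SLCS formulas: $\varphi::=a\mid\top\mid\neg\varphi\mid\varphi\wedge\varphi\mid\mathcal{N}\varphi\mid\varphi\,\mathcal{R}\,\varphi\mid\varphi\,\mathcal{P}\,\varphi$ ($a\in\mathsf{P}$). Semantics: $x\models a$ iff $a\in V(x)$; $\top$ always; Booleans as usual; $x\models\mathcal{N}\varphi$ iff $x\in\mathcal{C}(\{y\mid y\models\varphi\})$; $x\models\varphi\,\mathcal{R}\,\psi$ iff there are a path $p$ and $n$ with $p(n)=x$, $p(0)\models\psi$, and $p(i)\models\varphi$ for all $0<i\le n$; $x\models\varphi\,\mathcal{P}\,\psi$ iff there are a path $p$ with $p(0)=x$ and $n$ with $p(n)\models\psi$ and $p(i)\models\varphi$ for all $0\le i<n$. -}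

module Defs where

open import Level using (Level; _⊔_; Lift) renaming (suc to lsuc; zero to lzero)
open import Data.Nat using (ℕ; zero; suc; _<_; _≤_)
open import Data.Product using (Σ; _×_; _,_; ∃)
open import Data.Empty using (⊥)
open import Relation.Nullary using (¬_)
open import Relation.Binary.PropositionalEquality using (_≡_)
open import Function.Bundles using (_⇔_)

Subset : Set → Set₁
Subset X = X → Set

_⊆_ : {X : Set} → Subset X → Subset X → Set
A ⊆ B = ∀ y → A y → B y

_∩_ : {X : Set} → Subset X → Subset X → Subset X
(A ∩ B) y = A y × B y

∅ : {X : Set} → Subset X
∅ _ = ⊥

record QDSpace (X : Set) : Set₁ where
  field
    N          : X → Subset X → Set
    N-point    : ∀ x A → N x A → A x
    N-super    : ∀ x A B → N x A → A ⊆ B → N x B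
    N-inter    : ∀ x A B → N x A → N x B → N x (A ∩ B)
    N-proper   : ∀ x → ¬ N x ∅
    Nmin       : X → Subset X
    Nmin-nbhd  : ∀ x → N x (Nmin x)
    Nmin-least : ∀ x A → N x A → Nmin x ⊆ A

  C : ∀ {ℓ} → (X → Set ℓ) → X → Set (lsuc lzero ⊔ ℓ)
  C A x = ∀ M → N x M → ∃ λ y → A y × M y

  R : X → X → Set
  R x y = Nmin x y

  -- paths: continuous maps from the index space ℕ (minimal neighbourhood
  -- of n is {n, n+1}), i.e. p (n+1) ∈ Nmin (p n)
  IsPath : (ℕ → X) → Set
  IsPath p = ∀ n → Nmin (p n) (p (suc n))

record QDModel (AP : Set) : Set₁ where
  field
    Carrier : Set
    space   : QDSpace Carrier
    V       : Carrier → Subset AP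
  open QDSpace space public

data Formula (AP : Set) : Set where
  atom : AP → Formula AP
  ⊤f   : Formula AP
  ¬f_  : Formula AP → Formula AP
  _∧f_ : Formula AP → Formula AP → Formula AP
  𝒩_   : Formula AP → Formula AP
  _ℛ_  : Formula AP → Formula AP → Formula AP
  _𝒫_  : Formula AP → Formula AP → Formula AP

data NoR {AP : Set} : Formula AP → Set where
  atom : ∀ a → NoR (atom a)
  ⊤f   : NoR ⊤f
  ¬f_  : ∀ {φ} → NoR φ → NoR (¬f φ)
  _∧f_ : ∀ {φ ψ} → NoR φ → NoR ψ → NoR (φ ∧f ψ)
  𝒩_   : ∀ {φ} → NoR φ → NoR (𝒩 φ)
  _𝒫_  : ∀ {φ ψ} → NoR φ → NoR ψ → NoR (φ 𝒫 ψ)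

module _ {AP : Set} (M : QDModel AP) where
  open QDModel M

  _⊨_ : Carrier → Formula AP → Set₁
  x ⊨ atom a  = Lift _ (V x a)
  x ⊨ ⊤f      = Lift _ Data.Unit.⊤
    where import Data.Unit
  x ⊨ (¬f φ)  = ¬ (x ⊨ φ)
  x ⊨ (φ ∧f ψ) = (x ⊨ φ) × (x ⊨ ψ)
  x ⊨ (𝒩 φ)   = C (λ y → y ⊨ φ) x
  x ⊨ (φ ℛ ψ) = Σ (ℕ → Carrier) λ p → IsPath p × Σ ℕ λ n →
                  (p n ≡ x) × (p 0 ⊨ ψ) × (∀ i → 0 < i → i ≤ n → p i ⊨ φ)
  x ⊨ (φ 𝒫 ψ) = Σ (ℕ → Carrier) λ p → IsPath p × (p 0 ≡ x) × Σ ℕ λ n →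
                  (p n ⊨ ψ) × (∀ i → i < n → p i ⊨ φ)

record IsModalBisim {AP : Set} (M₁ M₂ : QDModel AP)
         (ρ : QDModel.Carrier M₁ → QDModel.Carrier M₂ → Set) : Set where
  private
    module M₁ = QDModel M₁
    module M₂ = QDModel M₂
  field
    val  : ∀ {x₁ x₂} → ρ x₁ x₂ → ∀ a → M₁.V x₁ a ⇔ M₂.V x₂ a
    zig  : ∀ {x₁ x₂} → ρ x₁ x₂ → ∀ y₁ → M₁.R x₁ y₁ →
             ∃ λ y₂ → M₂.R x₂ y₂ × ρ y₁ y₂
    zag  : ∀ {x₁ x₂} → ρ x₁ x₂ → ∀ y₂ → M₂.R x₂ y₂ →
             ∃ λ y₁ → M₁.R x₁ y₁ × ρ y₁ y₂

module Submission where

-- In a quasi-discrete space the closure operator is determined by the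
-- minimal neighbourhoods: x lies in the closure of A exactly when some
-- point of Nmin x lies in A.  Hence 𝒩 is the one-step "possibly" modality
-- of the edge relation R, which a modal bisimulation preserves (zig).
-- Likewise every path p in M₁ starting at a point related to x₂ can be
-- lifted step by step, again by zig, to a path q in M₂ starting at x₂
-- with ρ (p i) (q i) for all i; this transports the witnesses of 𝒫.
--
-- The
-- theorem is then a structural induction over ℛ-free formulas, where the
-- converse bisimulation supplies the backward direction.  (ℛ is excluded:
-- it looks at paths ending in a point, whose transfer would need edges to be
-- lifted backwards, which a modal bisimulation does not provide.)

open import Defs
open import Function.Bundles using (_⇔_; mk⇔; Equivalence)
open import Level using (lift; lower)
open import Data.Nat using (ℕ; zero; suc)
open import Data.Product using (Σ; _×_; _,_; ∃; proj₁; proj₂)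
open import Data.Unit using (tt)
open import Relation.Binary.PropositionalEquality using (refl)

open Equivalence using (to; from)

module _ {X : Set} (S : QDSpace X) where
  open QDSpace S

  closure-via-Nmin : ∀ {ℓ} (A : X → Set ℓ) (x : X) →
                     C A x ⇔ (∃ λ y → Nmin x y × A y)
  closure-via-Nmin A x = mk⇔ meets-Nmin from-Nmin
    where
    meets-Nmin : C A x → ∃ λ y → Nmin x y × A y
    meets-Nmin c with c (Nmin x) (Nmin-nbhd x)
    ... | y , Ay , y∈Nmin = y , y∈Nmin , Ay

    from-Nmin : (∃ λ y → Nmin x y × A y) → C A x
    from-Nmin (y , y∈Nmin , Ay) M x∈M = y , Ay , Nmin-least x M x∈M y y∈Nmin

converse : {AP : Set} {M₁ M₂ : QDModel AP}
           {ρ : QDModel.Carrier M₁ → QDModel.Carrier M₂ → Set} →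
           IsModalBisim M₁ M₂ ρ → IsModalBisim M₂ M₁ (λ x₂ x₁ → ρ x₁ x₂)
converse bisim = record
  { val = λ r a → mk⇔ (from (val r a)) (to (val r a))
  ; zig = zag
  ; zag = zig
  }
  where open IsModalBisim bisim

module Preservation {AP : Set} {M₁ M₂ : QDModel AP}
         {ρ : QDModel.Carrier M₁ → QDModel.Carrier M₂ → Set}
         (bisim : IsModalBisim M₁ M₂ ρ) where
  private
    module M₁ = QDModel M₁
    module M₂ = QDModel M₂
  open IsModalBisim bisim

  Preserved : Formula AP → Set₁
  Preserved φ = ∀ {x₁ x₂} → ρ x₁ x₂ → _⊨_ M₁ x₁ φ → _⊨_ M₂ x₂ φ

  module PathLifting (p : ℕ → M₁.Carrier) (p-path : M₁.IsPath p)
                     {x₂ : M₂.Carrier} (r₀ : ρ (p 0) x₂) where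

    lifted : (i : ℕ) → Σ M₂.Carrier (ρ (p i))
    lifted zero    = x₂ , r₀
    lifted (suc i) = let (y , _ , r) = zig (proj₂ (lifted i)) (p (suc i)) (p-path i)
                     in y , r

    q : ℕ → M₂.Carrier
    q i = proj₁ (lifted i)

    q-path : M₂.IsPath q
    q-path i = proj₁ (proj₂ (zig (proj₂ (lifted i)) (p (suc i)) (p-path i)))

    q-related : ∀ i → ρ (p i) (q i)
    q-related i = proj₂ (lifted i)

  -- 𝒩 is the one-step modality of R, so zig transports its witness.
  preserve-𝒩 : ∀ {φ} → Preserved φ → Preserved (𝒩 φ)
  preserve-𝒩 {φ} hφ {x₁} {x₂} r x₁⊨𝒩φ
    with to (closure-via-Nmin M₁.space (λ y → _⊨_ M₁ y φ) x₁) x₁⊨𝒩φ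
  ... | y₁ , y₁∈Nmin , y₁⊨φ with zig r y₁ y₁∈Nmin
  ... | y₂ , y₂∈Nmin , r' =
    from (closure-via-Nmin M₂.space (λ y → _⊨_ M₂ y φ) x₂) (y₂ , y₂∈Nmin , hφ r' y₁⊨φ)

  preserve-𝒫 : ∀ {φ ψ} → Preserved φ → Preserved ψ → Preserved (φ 𝒫 ψ)
  preserve-𝒫 hφ hψ r (p , p-path , refl , n , pn⊨ψ , before-n⊨φ) =
    q , q-path , refl , n , hψ (q-related n) pn⊨ψ ,
    λ i i<n → hφ (q-related i) (before-n⊨φ i i<n)
    where open PathLifting p p-path r

-- The two directions of the induction hypothesis, phrased as preservation
-- along the bisimulation and along its converse.
forward : ∀ {AP} {M₁ M₂ : QDModel AP} {ρ} (bisim : IsModalBisim M₁ M₂ ρ) →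
          ∀ {φ} → NoR φ → Preservation.Preserved bisim φ
backward : ∀ {AP} {M₁ M₂ : QDModel AP} {ρ} (bisim : IsModalBisim M₁ M₂ ρ) →
           ∀ {φ} → NoR φ → Preservation.Preserved (converse bisim) φ

bisim-invariance : {AP : Set} {M₁ M₂ : QDModel AP}
                   {ρ : QDModel.Carrier M₁ → QDModel.Carrier M₂ → Set} →
                   IsModalBisim M₁ M₂ ρ → ∀ {φ} → NoR φ →
                   ∀ {x₁ x₂} → ρ x₁ x₂ → (_⊨_ M₁ x₁ φ) ⇔ (_⊨_ M₂ x₂ φ)
bisim-invariance bisim (atom a) r =
  mk⇔ (λ v → lift (to (val r a) (lower v))) (λ v → lift (from (val r a) (lower v)))
  where open IsModalBisim bisim
bisim-invariance bisim ⊤f r = mk⇔ (λ _ → lift tt) (λ _ → lift tt)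
bisim-invariance bisim (¬f nφ) r =
  mk⇔ (λ ¬φ₁ φ₂ → ¬φ₁ (from (bisim-invariance bisim nφ r) φ₂))
      (λ ¬φ₂ φ₁ → ¬φ₂ (to (bisim-invariance bisim nφ r) φ₁))
bisim-invariance bisim (nφ ∧f nψ) r =
  mk⇔ (λ (φ₁ , ψ₁) → to (bisim-invariance bisim nφ r) φ₁ , to (bisim-invariance bisim nψ r) ψ₁)
      (λ (φ₂ , ψ₂) → from (bisim-invariance bisim nφ r) φ₂ , from (bisim-invariance bisim nψ r) ψ₂)
bisim-invariance bisim (𝒩 nφ) r =
  mk⇔ (Preservation.preserve-𝒩 bisim (forward bisim nφ) r)
      (Preservation.preserve-𝒩 (converse bisim) (backward bisim nφ) r)
bisim-invariance bisim (nφ 𝒫 nψ) r =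
  mk⇔ (Preservation.preserve-𝒫 bisim (forward bisim nφ) (forward bisim nψ) r)
      (Preservation.preserve-𝒫 (converse bisim) (backward bisim nφ) (backward bisim nψ) r)

forward bisim nφ r = to (bisim-invariance bisim nφ r)
backward bisim nφ r = from (bisim-invariance bisim nφ r)

theorem26 : {AP : Set} (M₁ M₂ : QDModel AP)
    (ρ : QDModel.Carrier M₁ → QDModel.Carrier M₂ → Set) →
    IsModalBisim M₁ M₂ ρ →
    ∀ {x₁ x₂} → ρ x₁ x₂ →
    (φ : Formula AP) → NoR φ →
    (_⊨_ M₁ x₁ φ) ⇔ (_⊨_ M₂ x₂ φ)
theorem26 M₁ M₂ ρ bisim r φ nφ = bisim-invariance bisim nφ r
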